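{- Let $d_1, d_2$ be positive integers. There exists a constant $H$ (depending on $d_1,d_2$) such that whenever $g_1, g_2 \in \mathbb{Z}[x]$ have degrees $d_1$ and $d_2$ respectively and $\mathrm{ht}(g_1) > H$ or $\mathrm{ht}(g_2) > H$, then $\mathrm{ht}(g_1 g_2) > \min\{\mathrm{ht}(g_1), \mathrm{ht}(g_2)\}$.
   Context: The height $\mathrm{ht}(h)$ of a polynomial $h = \sum c_i x^i$ is $\max_i |c_i|$. -}

module Defs where

open import Data.Nat using (ℕ; zero; suc; _⊔_)
open import Data.Integer using (ℤ; ∣_∣; _+_; _*_; 0ℤ)
open import Data.List using (List; []; _∷_; map; foldr)
open import Data.Vec using (Vec; toList; last)
open import Relation.Binary.PropositionalEquality using (_≢_)

-- A polynomial in ℤ[x] is represented by its coefficient list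
-- [c₀, c₁, …, cₙ] (lowest degree first).
Poly : Set
Poly = List ℤ

addP : Poly → Poly → Poly
addP []       q        = q
addP (a ∷ p)  []       = a ∷ p
addP (a ∷ p)  (b ∷ q)  = (a + b) ∷ addP p q

-- Polynomial multiplication: (a + x p) q = a q + x (p q).
mulP : Poly → Poly → Poly
mulP []       q = []
mulP (a ∷ p)  q = addP (map (a *_) q) (0ℤ ∷ mulP p q)

ht : Poly → ℕ
ht = foldr (λ c m → ∣ c ∣ ⊔ m) 0

record PolyDeg (d : ℕ) : Set where
  constructor mkPolyDeg
  field
    coeffs  : Vec ℤ (suc d)
    leading : last coeffs ≢ 0ℤ

open PolyDeg public

toPoly : ∀ {d} → PolyDeg d → Poly
toPoly g = toList (coeffs g)

module Submission where

-- The heart of the proof is a Gelfond-type inequality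
--     ht f * ht g ≤ D * ht (f g),      D depending only on the lengths of f, g,
-- obtained by evaluating at small integer points.  Put K = length f + length g.
--  * Interpolation: a polynomial with n coefficients that is bounded by M at
--    n distinct points of {0, …, K-1} has height at most C K n * M.  This is
--    proved by induction on n, dividing by (x - s) at the smallest point s
--    (Ruffini's rule) and recovering the coefficients from the quotient.
--  * Hence fewer than length f of the points t < K are "small" for f, i.e.
--    satisfy C * |f(t)| < ht f; likewise for g.  Counting, some t < K is small
--    for neither, and there ht f * ht g ≤ C₁ C₂ |f(t) g(t)| ≤ D * ht (f g).
-- The theorem follows: if ht (f g) ≤ min (ht f) (ht g), then
-- max (ht f) (ht g) * min (ht f) (ht g) = ht f * ht g ≤ D * min (ht f) (ht g)
-- forces max (ht f) (ht g) ≤ D.  So H = D works.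

open import Defs
open import Data.Nat using (ℕ; suc; _<_; _⊓_)
open import Data.Product using (∃-syntax; _×_; _,_; proj₁; proj₂)
open import Data.Sum using (_⊎_)
open import Data.Integer using (ℤ; +_; ∣_∣; 0ℤ)
open import Data.List using ([]; _∷_; length)
open import Relation.Binary.PropositionalEquality

module Evaluation where

  open import Data.Integer using (_+_; _*_; _-_)
  import Data.Integer.Properties as ℤ
  open import Data.Integer.Tactic.RingSolver using (solve-∀)
  open import Data.List using (map)
  open ≡-Reasoning

  ev : Poly → ℤ → ℤ
  ev []      t = 0ℤ
  ev (a ∷ p) t = a + t * ev p t

  ev-addP : ∀ p q t → ev (addP p q) t ≡ ev p t + ev q t
  ev-addP []      q       t = sym (ℤ.+-identityˡ (ev q t))
  ev-addP (a ∷ p) []      t = sym (ℤ.+-identityʳ _)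
  ev-addP (a ∷ p) (b ∷ q) t = begin
    (a + b) + t * ev (addP p q) t    ≡⟨ cong (λ z → (a + b) + t * z) (ev-addP p q t) ⟩
    (a + b) + t * (ev p t + ev q t)  ≡⟨ interchange a b t (ev p t) (ev q t) ⟩
    (a + t * ev p t) + (b + t * ev q t) ∎
    where
    interchange : ∀ a b t x y → (a + b) + t * (x + y) ≡ (a + t * x) + (b + t * y)
    interchange = solve-∀

  ev-scale : ∀ a q t → ev (map (a *_) q) t ≡ a * ev q t
  ev-scale a []      t = sym (ℤ.*-zeroʳ a)
  ev-scale a (b ∷ q) t = begin
    a * b + t * ev (map (a *_) q) t  ≡⟨ cong (λ z → a * b + t * z) (ev-scale a q t) ⟩
    a * b + t * (a * ev q t)         ≡⟨ factor a b t (ev q t) ⟩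
    a * (b + t * ev q t)             ∎
    where
    factor : ∀ a b t x → a * b + t * (a * x) ≡ a * (b + t * x)
    factor = solve-∀

  ev-mulP : ∀ p q t → ev (mulP p q) t ≡ ev p t * ev q t
  ev-mulP []      q t = refl
  ev-mulP (a ∷ p) q t = begin
    ev (addP (map (a *_) q) (0ℤ ∷ mulP p q)) t          ≡⟨ ev-addP (map (a *_) q) _ t ⟩
    ev (map (a *_) q) t + (0ℤ + t * ev (mulP p q) t)     ≡⟨ cong₂ (λ u v → u + (0ℤ + t * v))
                                                                   (ev-scale a q t) (ev-mulP p q t) ⟩
    a * ev q t + (0ℤ + t * (ev p t * ev q t))            ≡⟨ factor a t (ev p t) (ev q t) ⟩
    (a + t * ev p t) * ev q t                            ∎
    where
    factor : ∀ a t P Q → a * Q + (0ℤ + t * (P * Q)) ≡ (a + t * P) * Q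
    factor = solve-∀

  -- Synthetic division by (x - s): the quotient q with p = (x - s) q + p(s).
  -- Its coefficients are the partial Horner values of p at s.
  quotient : ℤ → Poly → Poly
  quotient s []          = []
  quotient s (a ∷ [])    = []
  quotient s (a ∷ b ∷ p) = ev (b ∷ p) s ∷ quotient s (b ∷ p)

  ruffini : ∀ s p t → ev p t ≡ (t - s) * ev (quotient s p) t + ev p s
  ruffini s []          t = solve t s
    where
    solve : ∀ t s → 0ℤ ≡ (t - s) * 0ℤ + 0ℤ
    solve = solve-∀
  ruffini s (a ∷ [])    t = constant a t s
    where
    constant : ∀ a t s → a + t * 0ℤ ≡ (t - s) * 0ℤ + (a + s * 0ℤ)
    constant = solve-∀
  ruffini s (a ∷ b ∷ p) t = begin
    a + t * ev (b ∷ p) t                                ≡⟨ cong (λ z → a + t * z) (ruffini s (b ∷ p) t) ⟩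
    a + t * ((t - s) * ev (quotient s (b ∷ p)) t + R)   ≡⟨ step a t s (ev (quotient s (b ∷ p)) t) R ⟩
    (t - s) * (R + t * ev (quotient s (b ∷ p)) t) + (a + s * R) ∎
    where
    R = ev (b ∷ p) s
    step : ∀ a t s Q R → a + t * ((t - s) * Q + R) ≡ (t - s) * (R + t * Q) + (a + s * R)
    step = solve-∀

  quotient-length : ∀ s a p → length (quotient s (a ∷ p)) ≡ length p
  quotient-length s a []      = refl
  quotient-length s a (b ∷ p) = cong suc (quotient-length s b p)

  ev-constant : ∀ a t → ev (a ∷ []) t ≡ a
  ev-constant = constant
    where
    constant : ∀ a t → a + t * 0ℤ ≡ a
    constant = solve-∀

  quotient-difference : ∀ s p t → (t - s) * ev (quotient s p) t ≡ ev p t - ev p s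
  quotient-difference s p t = isolate (ruffini s p t)
    where
    isolate : ∀ {x y r} → x ≡ y + r → y ≡ x - r
    isolate {y = y} {r} refl = cancel y r
      where
      cancel : ∀ y r → y ≡ (y + r) - r
      cancel = solve-∀

  constant-coefficient : ∀ s a b p → a ≡ ev (a ∷ b ∷ p) s - s * ev (b ∷ p) s
  constant-coefficient s a b p = cancel a s (ev (b ∷ p) s)
    where
    cancel : ∀ a s R → a ≡ (a + s * R) - s * R
    cancel = solve-∀

open Evaluation using (ev; ev-mulP; quotient; quotient-length; quotient-difference; ev-constant; constant-coefficient)

module Heights where

  open import Data.Nat using (zero; _+_; _*_; _^_; _≤_; _⊔_; z≤n; s≤s; _<?_; NonZero; ≢-nonZero; >-nonZero)
  import Data.Nat.Properties as ℕ
  open import Data.Nat.Tactic.RingSolver using (solve-∀)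
  import Data.Integer as ℤ
  import Data.Integer.Properties as ℤ
  open import Data.List using (map; filter; upTo)
  open import Data.List.Properties using (length-map; length-upTo)
  open import Data.List.Extrema.Nat using (max; argmax-all; xs≤max)
  open import Data.List.Relation.Unary.All as All using (All; []; _∷_)
  import Data.List.Relation.Unary.All.Properties as All
  open import Data.List.Relation.Unary.AllPairs using (AllPairs; []; _∷_)
  import Data.List.Relation.Unary.AllPairs.Properties as AllPairs
  open import Data.List.Relation.Unary.Any as Any using (Any; here; there)
  open import Data.Vec using (Vec; last; toList)
  open import Data.Vec.Properties using (length-toList)
  import Data.Vec as Vec
  open import Data.Sum using (inj₁; inj₂; [_,_]′)
  open import Function using (id)
  open import Relation.Nullary using (¬_; yes; no)
  open import Relation.Unary using (Decidable)
  open ℕ.≤-Reasoning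

  length-addP : ∀ p q → length (addP p q) ≤ length p ⊔ length q
  length-addP []      q       = ℕ.≤-refl
  length-addP (a ∷ p) []      = ℕ.≤-refl
  length-addP (a ∷ p) (b ∷ q) = s≤s (length-addP p q)

  length-mulP : ∀ p q → length (mulP p q) ≤ length p + length q
  length-mulP []      q = z≤n
  length-mulP (a ∷ p) q = ℕ.≤-trans (length-addP (map (a ℤ.*_) q) _)
    (ℕ.⊔-lub (ℕ.≤-trans (ℕ.≤-reflexive (length-map (a ℤ.*_) q))
                        (ℕ.m≤n+m _ (suc (length p))))
             (s≤s (length-mulP p q)))

  ev-bound : ∀ t p → ∣ ev p (+ t) ∣ ≤ ht p * suc t ^ length p
  ev-bound t []      = z≤n
  ev-bound t (a ∷ p) = begin
    ∣ a ℤ.+ + t ℤ.* ev p (+ t) ∣      ≤⟨ ℤ.∣i+j∣≤∣i∣+∣j∣ a _ ⟩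
    ∣ a ∣ + ∣ + t ℤ.* ev p (+ t) ∣    ≡⟨ cong (_+_ ∣ a ∣) (ℤ.∣i*j∣≡∣i∣*∣j∣ (+ t) _) ⟩
    ∣ a ∣ + t * ∣ ev p (+ t) ∣        ≤⟨ ℕ.+-mono-≤ head-bound (ℕ.*-monoʳ-≤ t tail-bound) ⟩
    h * X + t * (h * X)               ≡⟨ collect h X t ⟩
    h * (suc t * X)                   ∎
    where
    h = ht (a ∷ p)
    X = suc t ^ length p
    head-bound : ∣ a ∣ ≤ h * X
    head-bound = ℕ.≤-trans (ℕ.m≤m⊔n ∣ a ∣ (ht p)) (ℕ.m≤m*n h X {{ℕ.m^n≢0 (suc t) (length p)}})
    tail-bound : ∣ ev p (+ t) ∣ ≤ h * X
    tail-bound = ℕ.≤-trans (ev-bound t p) (ℕ.*-monoˡ-≤ X (ℕ.m≤n⊔m ∣ a ∣ (ht p)))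
    collect : ∀ h X t → h * X + t * (h * X) ≡ h * (suc t * X)
    collect = solve-∀

  value-bound : ∀ {K x} p → x < K → length p ≤ K → ∣ ev p (+ x) ∣ ≤ ht p * K ^ K
  value-bound {zero}  p () _
  value-bound {suc k} {x} p x<K p≤K = ℕ.≤-trans (ev-bound x p)
    (ℕ.*-monoʳ-≤ (ht p) (ℕ.≤-trans (ℕ.^-monoˡ-≤ (length p) x<K) (ℕ.^-monoʳ-≤ (suc k) p≤K)))

  -- Between two points s < s', a value bound M for p bounds the quotient of p
  -- by (x - s) at s' by 2M, since (s' - s) q(s') = p(s') - p(s) and s' - s ≠ 0.
  quotient-value-bound : ∀ {s s' M} p → s < s' → ∣ ev p (+ s') ∣ ≤ M → ∣ ev p (+ s) ∣ ≤ M →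
                         ∣ ev (quotient (+ s) p) (+ s') ∣ ≤ 2 * M
  quotient-value-bound {s} {s'} {M} p s<s' ps'≤M ps≤M = begin
    ∣ Q ∣                    ≤⟨ ℕ.m≤n*m ∣ Q ∣ ∣ d ∣ {{≢-nonZero d≢0}} ⟩
    ∣ d ∣ * ∣ Q ∣            ≡⟨ sym (ℤ.∣i*j∣≡∣i∣*∣j∣ d Q) ⟩
    ∣ d ℤ.* Q ∣              ≡⟨ cong ∣_∣ (quotient-difference (+ s) p (+ s')) ⟩
    ∣ ev p (+ s') ℤ.- ev p (+ s) ∣ ≤⟨ ℤ.∣i-j∣≤∣i∣+∣j∣ (ev p (+ s')) (ev p (+ s)) ⟩
    ∣ ev p (+ s') ∣ + ∣ ev p (+ s) ∣ ≤⟨ ℕ.+-mono-≤ ps'≤M ps≤M ⟩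
    M + M                    ≡⟨ cong (_+_ M) (sym (ℕ.+-identityʳ M)) ⟩
    2 * M                    ∎
    where
    d = + s' ℤ.- + s
    Q = ev (quotient (+ s) p) (+ s')
    d≢0 : ∣ d ∣ ≢ 0
    d≢0 eq = ℕ.<⇒≢ s<s' (sym (ℤ.+-injective (ℤ.i-j≡0⇒i≡j (+ s') (+ s) (ℤ.∣i∣≡0⇒i≡0 eq))))

  coefficient-bound : ∀ s p {B} → ht (quotient (+ s) p) ≤ B → ∣ ev p (+ s) ∣ ≤ B →
                      ht p ≤ suc s * B
  coefficient-bound s []          q≤B p≤B = z≤n
  coefficient-bound s (a ∷ [])    q≤B p≤B = ℕ.⊔-lub
    (ℕ.≤-trans (ℕ.≤-reflexive (cong ∣_∣ (sym (ev-constant a (+ s))))) (ℕ.≤-trans p≤B (ℕ.m≤n*m _ (suc s))))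
    z≤n
  coefficient-bound s (a ∷ b ∷ p) {B} q≤B p≤B = ℕ.⊔-lub a-bound
    (coefficient-bound s (b ∷ p) (ℕ.m⊔n≤o⇒n≤o ∣ R ∣ _ q≤B) R≤B)
    where
    R = ev (b ∷ p) (+ s)
    R≤B : ∣ R ∣ ≤ B
    R≤B = ℕ.m⊔n≤o⇒m≤o ∣ R ∣ _ q≤B
    a-bound : ∣ a ∣ ≤ suc s * B
    a-bound = begin
      ∣ a ∣                                  ≡⟨ cong ∣_∣ (constant-coefficient (+ s) a b p) ⟩
      ∣ ev (a ∷ b ∷ p) (+ s) ℤ.- + s ℤ.* R ∣ ≤⟨ ℤ.∣i-j∣≤∣i∣+∣j∣ (ev (a ∷ b ∷ p) (+ s)) (+ s ℤ.* R) ⟩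
      ∣ ev (a ∷ b ∷ p) (+ s) ∣ + ∣ + s ℤ.* R ∣ ≡⟨ cong (_+_ ∣ ev (a ∷ b ∷ p) (+ s) ∣) (ℤ.∣i*j∣≡∣i∣*∣j∣ (+ s) R) ⟩
      ∣ ev (a ∷ b ∷ p) (+ s) ∣ + s * ∣ R ∣   ≤⟨ ℕ.+-mono-≤ p≤B (ℕ.*-monoʳ-≤ s R≤B) ⟩
      B + s * B                              ∎

  C : ℕ → ℕ → ℕ
  C K zero    = 0
  C K (suc n) = K * (2 * C K n + 1)

  interpolation-bound : ∀ {K} pts → AllPairs _<_ pts → All (_< K) pts →
                        ∀ p → length p ≤ length pts → ∀ {M} →
                        All (λ s → ∣ ev p (+ s) ∣ ≤ M) pts → ht p ≤ C K (length p) * M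
  interpolation-bound pts _ _ [] _ _ = z≤n
  interpolation-bound {K} (s ∷ pts) (s<pts ∷ sorted) (s<K ∷ pts<K) (a ∷ p) (s≤s p≤pts) {M}
                      (ps≤M ∷ pts≤M) = begin
    ht (a ∷ p)                     ≤⟨ coefficient-bound s (a ∷ p) q≤B (ℕ.≤-trans ps≤M (ℕ.m≤n+m M _)) ⟩
    suc s * (C K n * (2 * M) + M)  ≤⟨ ℕ.*-monoˡ-≤ _ s<K ⟩
    K * (C K n * (2 * M) + M)      ≡⟨ regroup K (C K n) M ⟩
    C K (suc n) * M                ∎
    where
    n = length p
    q = quotient (+ s) (a ∷ p)
    q-values : All (λ s' → ∣ ev q (+ s') ∣ ≤ 2 * M) pts
    q-values = All.zipWith (λ (s<s' , ps'≤M) → quotient-value-bound (a ∷ p) s<s' ps'≤M ps≤M)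
                           (s<pts , pts≤M)
    q-length : length q ≡ n
    q-length = quotient-length (+ s) a p
    q-height : ht q ≤ C K n * (2 * M)
    q-height = subst (λ m → ht q ≤ C K m * (2 * M)) q-length
      (interpolation-bound pts sorted pts<K q (subst (_≤ length pts) (sym q-length) p≤pts) q-values)
    q≤B : ht q ≤ C K n * (2 * M) + M
    q≤B = ℕ.≤-trans q-height (ℕ.m≤m+n _ M)
    regroup : ∀ K c M → K * (c * (2 * M) + M) ≡ K * (2 * c + 1) * M
    regroup = solve-∀

  Small : ℕ → Poly → ℕ → Set
  Small K p t = C K (length p) * ∣ ev p (+ t) ∣ < ht p

  small? : ∀ K p → Decidable (Small K p)
  small? K p t = C K (length p) * ∣ ev p (+ t) ∣ <? ht p

  -- A nonzero polynomial has fewer small points below K than coefficients: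
  -- otherwise interpolation at the small points bounds ht p below itself.
  few-small-points : ∀ K p → 0 < ht p → length (filter (small? K p) (upTo K)) < length p
  few-small-points K p p≢0 = ℕ.≰⇒> λ p≤S →
    ℕ.<⇒≱ CM<ht (interpolation-bound S sorted bounded p p≤S (All.map⁻ (xs≤max 0 (map v S))))
    where
    S = filter (small? K p) (upTo K)
    v : ℕ → ℕ
    v t = ∣ ev p (+ t) ∣
    sorted : AllPairs _<_ S
    sorted = AllPairs.filter⁺ (small? K p) (AllPairs.applyUpTo⁺₁ id K (λ i<j _ → i<j))
    bounded : All (_< K) S
    bounded = All.filter⁺ (small? K p) (All.all-upTo K)
    CM<ht : C K (length p) * max 0 (map v S) < ht p
    CM<ht = argmax-all id {P = λ m → C K (length p) * m < ht p}
      (subst (_< ht p) (sym (ℕ.*-zeroʳ (C K (length p)))) p≢0)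
      (All.map⁺ (All.all-filter (small? K p) (upTo K)))

  avoid-both : ∀ {A : Set} {P Q : A → Set} (P? : Decidable P) (Q? : Decidable Q) xs →
               length (filter P? xs) + length (filter Q? xs) < length xs →
               Any (λ x → ¬ P x × ¬ Q x) xs
  avoid-both P? Q? (x ∷ xs) count with P? x | Q? x
  ... | no ¬p | no ¬q = here (¬p , ¬q)
  ... | yes _ | yes _ = there (avoid-both P? Q? xs
    (ℕ.≤-trans (s≤s (ℕ.+-monoʳ-≤ (length (filter P? xs)) (ℕ.n≤1+n _))) (ℕ.≤-pred count)))
  ... | yes _ | no _  = there (avoid-both P? Q? xs (ℕ.≤-pred count))
  ... | no _  | yes _ = there (avoid-both P? Q? xs
    (subst (_≤ length xs) (ℕ.+-suc _ _) (ℕ.≤-pred count)))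

  gelfond-constant : ℕ → ℕ → ℕ
  gelfond-constant L₁ L₂ = C K L₁ * C K L₂ * K ^ K
    where K = L₁ + L₂

  -- Gelfond-type inequality: ht f * ht g ≤ D * ht (f g) for nonzero f, g.
  -- Evaluate at a point x < K that is small for neither f nor g.
  gelfond : ∀ f g → 0 < ht f → 0 < ht g →
            ht f * ht g ≤ gelfond-constant (length f) (length g) * ht (mulP f g)
  gelfond f g f≢0 g≢0 = begin
    ht f * ht g                   ≤⟨ ℕ.*-mono-≤ (ℕ.≮⇒≥ f-large) (ℕ.≮⇒≥ g-large) ⟩
    (C₁ * ∣ F ∣) * (C₂ * ∣ G ∣)   ≡⟨ regroup C₁ C₂ ∣ F ∣ ∣ G ∣ ⟩
    C₁ * C₂ * (∣ F ∣ * ∣ G ∣)     ≡⟨ cong (C₁ * C₂ *_) ∣FG∣ ⟩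
    C₁ * C₂ * ∣ ev (mulP f g) (+ x) ∣
                                  ≤⟨ ℕ.*-monoʳ-≤ (C₁ * C₂) (value-bound (mulP f g) x<K (length-mulP f g)) ⟩
    C₁ * C₂ * (ht (mulP f g) * K ^ K) ≡⟨ reorder C₁ C₂ (ht (mulP f g)) (K ^ K) ⟩
    gelfond-constant (length f) (length g) * ht (mulP f g) ∎
    where
    K  = length f + length g
    C₁ = C K (length f)
    C₂ = C K (length g)
    count : length (filter (small? K f) (upTo K)) + length (filter (small? K g) (upTo K)) < length (upTo K)
    count = subst (length (filter (small? K f) (upTo K)) + length (filter (small? K g) (upTo K)) <_)
                  (sym (length-upTo K))
                  (ℕ.+-mono-< (few-small-points K f f≢0) (few-small-points K g g≢0))
    good : Any (λ t → ¬ Small K f t × ¬ Small K g t) (upTo K)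
    good = avoid-both (small? K f) (small? K g) (upTo K) count
    x = Any.lookup good
    x-properties : x < K × ¬ Small K f x × ¬ Small K g x
    x-properties = All.lookupAny (All.all-upTo K) good
    x<K : x < K
    x<K = proj₁ x-properties
    f-large : ¬ Small K f x
    f-large = proj₁ (proj₂ x-properties)
    g-large : ¬ Small K g x
    g-large = proj₂ (proj₂ x-properties)
    F = ev f (+ x)
    G = ev g (+ x)
    ∣FG∣ : ∣ F ∣ * ∣ G ∣ ≡ ∣ ev (mulP f g) (+ x) ∣
    ∣FG∣ = trans (sym (ℤ.∣i*j∣≡∣i∣*∣j∣ F G)) (cong ∣_∣ (sym (ev-mulP f g (+ x))))
    regroup : ∀ c d a b → (c * a) * (d * b) ≡ c * d * (a * b)
    regroup = solve-∀
    reorder : ∀ c d m X → c * d * (m * X) ≡ c * d * X * m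
    reorder = solve-∀

  max*min≡product : ∀ m n → (m ⊔ n) * (m ⊓ n) ≡ m * n
  max*min≡product m n with ℕ.≤-total m n
  ... | inj₁ m≤n rewrite ℕ.m≤n⇒m⊔n≡n m≤n | ℕ.m≤n⇒m⊓n≡m m≤n = ℕ.*-comm n m
  ... | inj₂ n≤m rewrite ℕ.m≥n⇒m⊔n≡m n≤m | ℕ.m≥n⇒m⊓n≡n n≤m = refl

  -- If h₁ h₂ ≤ D m for positive h₁, h₂ and one of them exceeds D, then
  -- m > min h₁ h₂: otherwise max h₁ h₂ * min h₁ h₂ ≤ D * min h₁ h₂.
  min-below : ∀ {h₁ h₂ m D} → 0 < h₁ → 0 < h₂ → h₁ * h₂ ≤ D * m →
              D < h₁ ⊎ D < h₂ → h₁ ⊓ h₂ < m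
  min-below {h₁} {h₂} {m} {D} h₁≢0 h₂≢0 product≤ big = ℕ.≰⇒> λ m≤min →
    ℕ.<⇒≱ D<max (ℕ.*-cancelʳ-≤ (h₁ ⊔ h₂) D (h₁ ⊓ h₂) {{min≢0}} (begin
      (h₁ ⊔ h₂) * (h₁ ⊓ h₂) ≡⟨ max*min≡product h₁ h₂ ⟩
      h₁ * h₂               ≤⟨ product≤ ⟩
      D * m                 ≤⟨ ℕ.*-monoʳ-≤ D m≤min ⟩
      D * (h₁ ⊓ h₂)         ∎))
    where
    min≢0 : NonZero (h₁ ⊓ h₂)
    min≢0 = >-nonZero (ℕ.⊓-glb h₁≢0 h₂≢0)
    D<max : D < h₁ ⊔ h₂
    D<max = [ ℕ.m<n⇒m<n⊔o h₂ , ℕ.m<n⇒m<o⊔n h₁ ]′ big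

  last≤ht : ∀ {n} (v : Vec ℤ (suc n)) → ∣ last v ∣ ≤ ht (toList v)
  last≤ht {zero}  (a Vec.∷ Vec.[]) = ℕ.m≤m⊔n _ _
  last≤ht {suc n} (a Vec.∷ v)      = ℕ.≤-trans (last≤ht v) (ℕ.m≤n⊔m ∣ a ∣ _)

  ht-positive : ∀ {d} (g : PolyDeg d) → 0 < ht (toPoly g)
  ht-positive g = ℕ.<-≤-trans (ℕ.n≢0⇒n>0 (λ eq → leading g (ℤ.∣i∣≡0⇒i≡0 eq))) (last≤ht (coeffs g))

  gelfond-degrees : ∀ {d₁ d₂} (g₁ : PolyDeg d₁) (g₂ : PolyDeg d₂) →
                    ht (toPoly g₁) * ht (toPoly g₂) ≤
                    gelfond-constant (suc d₁) (suc d₂) * ht (mulP (toPoly g₁) (toPoly g₂))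
  gelfond-degrees g₁ g₂ =
    subst₂ (λ L₁ L₂ → ht (toPoly g₁) * ht (toPoly g₂) ≤ gelfond-constant L₁ L₂ * ht (mulP (toPoly g₁) (toPoly g₂)))
           (length-toList (coeffs g₁)) (length-toList (coeffs g₂))
           (gelfond (toPoly g₁) (toPoly g₂) (ht-positive g₁) (ht-positive g₂))

open Heights using (gelfond-constant; gelfond-degrees; min-below; ht-positive)

lemma1 : (d₁ d₂ : ℕ) → ∃[ H ] ((g₁ : PolyDeg (suc d₁)) (g₂ : PolyDeg (suc d₂)) →
           H < ht (toPoly g₁) ⊎ H < ht (toPoly g₂) →
           ht (toPoly g₁) ⊓ ht (toPoly g₂) < ht (mulP (toPoly g₁) (toPoly g₂)))
lemma1 d₁ d₂ = gelfond-constant (suc (suc d₁)) (suc (suc d₂)) , λ g₁ g₂ →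
  min-below (ht-positive g₁) (ht-positive g₂) (gelfond-degrees g₁ g₂)
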